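{- Let $N$ be a finite nonempty nilpotent semigroup with $|N|=n$. Then the subsemigroup complex ${\cal H}(N)$ is the uniform matroid $U_{n,n}$; that is, every subset of $N$ is a face of ${\cal H}(N)$.
   Context: A semigroup $N$ with zero $0$ is nilpotent if $N^k=\{0\}$ for some positive integer $k$. For a finite nonempty semigroup $S$ and $Y\subseteq S$, $Y^+$ denotes the subsemigroup generated by $Y$ ($\emptyset^+=\emptyset$). The subsemigroup complex ${\cal H}(S)$ has vertex set $S$, and $X\subseteq S$ is a face iff it admits an enumeration $x_1,\dots,x_k$ with $\emptyset\subset\{x_1\}^+\subset\{x_1,x_2\}^+\subset\cdots\subset\{x_1,\dots,x_k\}^+$ (all inclusions strict). -}

module Defs where

open import Data.Nat using (ℕ; suc; _<_)
open import Data.Fin using (Fin)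
open import Data.Fin.Subset using (Subset) renaming (_∈_ to _∈ₛ_)
open import Data.List using (List; []; _∷_; length; take)
open import Data.List.Relation.Unary.All using (All)
open import Data.List.Relation.Unary.Unique.Propositional using (Unique)
open import Data.List.Membership.Propositional using (_∈_)
open import Data.Vec using (Vec; _∷_)
open import Data.Product using (Σ; _×_; ∃; ∃-syntax)
open import Function.Bundles using (_⇔_)
open import Relation.Binary.PropositionalEquality using (_≡_)
open import Relation.Nullary using (¬_)

-- A finite semigroup of order n: carrier Fin n with an associative operation.
-- (Every finite semigroup of order n is isomorphic to one of this form.)
Associative : {n : ℕ} → (Fin n → Fin n → Fin n) → Set
Associative _∙_ = ∀ x y z → ((x ∙ y) ∙ z) ≡ (x ∙ (y ∙ z))

module _ {n : ℕ} (_∙_ : Fin n → Fin n → Fin n) where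

  prod : Fin n → List (Fin n) → Fin n
  prod x []       = x
  prod x (y ∷ ys) = x ∙ prod y ys

  prodVec : {k : ℕ} → Vec (Fin n) (suc k) → Fin n
  prodVec (x ∷ xs) = prod x (Data.Vec.toList xs)

  IsZero : Fin n → Set
  IsZero z = ∀ x → ((z ∙ x) ≡ z) × ((x ∙ z) ≡ z)

  -- N is nilpotent: it has a zero 0 and N^k = {0} for some positive k,
  -- i.e. every product of k elements equals 0 (k = suc k').
  Nilpotent : Set
  Nilpotent = ∃[ z ] (IsZero z × ∃[ k ] (∀ (v : Vec (Fin n) (suc k)) → prodVec v ≡ z))

  -- Y⁺ for Y given as a list: all products of nonempty sequences of elements of Y.
  -- (For Y = [] this is empty.)
  _∈⁺_ : Fin n → List (Fin n) → Set
  x ∈⁺ ys = ∃[ a ] ∃[ as ] ((a ∈ ys) × All (_∈ ys) as × (prod a as ≡ x))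

  _⊂⁺_ : List (Fin n) → List (Fin n) → Set
  ys ⊂⁺ zs = (∀ x → x ∈⁺ ys → x ∈⁺ zs) × ∃[ x ] (x ∈⁺ zs × ¬ (x ∈⁺ ys))

  -- X is a face of the subsemigroup complex H(N): it has an enumeration
  -- x₁,…,x_k (a duplicate-free list with exactly the elements of X) such that
  -- ∅ ⊂ {x₁}⁺ ⊂ {x₁,x₂}⁺ ⊂ ⋯ ⊂ {x₁,…,x_k}⁺ with all inclusions strict.
  IsFace : Subset n → Set
  IsFace X = Σ (List (Fin n)) λ xs →
    Unique xs × (∀ i → (i ∈ₛ X) ⇔ (i ∈ xs)) ×
    (∀ j → j < length xs → take j xs ⊂⁺ take (suc j) xs)

-- Call rank : N → ℕ a grading if a·c ≠ 0 implies rank a < rank (a·c), and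
-- every a with rank a ≥ rank 0 equals 0.  Enumerate X by decreasing rank.
-- If xᵢ were generated by x₁,…,x_{i-1}, say xᵢ = a·c₁⋯c_m with a earlier
-- (so a ≠ xᵢ and rank a ≥ rank xᵢ), then m > 0, xᵢ ≠ 0 contradicts
-- rank a < rank xᵢ, and xᵢ = 0 forces a = 0.  Hence every step of the chain
-- {x₁}⁺ ⊂ {x₁,x₂}⁺ ⊂ ⋯ is strict.  If N^(k+1) = {0}, then
-- rank x = #{ j ≤ k+1 : x ∈ N^j } is a grading.
module Submission where

open import Defs
open import Data.Nat using (ℕ; suc; zero; _≤_; _<_; _+_; z≤n; s≤s)
open import Data.Nat.Properties
  using (≤-refl; ≤-trans; ≤-reflexive; +-assoc; +-comm; +-identityʳ; +-mono-≤; <⇒≱; ≤-decTotalOrder; module ≤-Reasoning)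
open import Data.Fin using (Fin)
open import Data.Fin.Properties using (any?; _≟_)
open import Data.Fin.Subset using (Subset) renaming (_∈_ to _∈ₛ_)
open import Data.Fin.Subset.Properties using () renaming (_∈?_ to _∈ₛ?_)
open import Data.List using (List; []; _∷_; length; take; _++_; [_]; filter; allFin)
open import Data.List.Properties using (++-identityʳ; ++-assoc)
open import Data.List.Relation.Unary.All as All using (All; []; _∷_)
open import Data.List.Relation.Unary.All.Properties using (++⁺)
open import Data.List.Relation.Unary.AllPairs as AllPairs using (AllPairs; []; _∷_)
open import Data.List.Relation.Unary.Any using (here)
open import Data.List.Relation.Unary.Unique.Propositional using (Unique)
open import Data.List.Relation.Unary.Unique.Propositional.Properties using (allFin⁺; filter⁺)
open import Data.List.Relation.Unary.Sorted.TotalOrder.Properties using (Sorted⇒AllPairs)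
open import Data.List.Relation.Binary.Subset.Propositional using (_⊆_)
open import Data.List.Relation.Binary.Permutation.Propositional using (↭-sym; ↭⇒↭ₛ)
open import Data.List.Relation.Binary.Permutation.Propositional.Properties using (∈-resp-↭)
open import Data.List.Membership.Propositional using (_∈_)
open import Data.List.Membership.Propositional.Properties using (∈-++⁺ˡ; ∈-++⁺ʳ; ∈-filter⁺; ∈-filter⁻; ∈-allFin)
import Data.List.Relation.Binary.Permutation.Setoid.Properties as SetoidPermutation
import Data.List.Sort as Sort
open import Data.Vec using (Vec; _∷_; [])
open import Data.Product using (_×_; ∃-syntax; _,_; proj₁; proj₂)
open import Data.Unit using (⊤; tt)
open import Data.Empty using (⊥-elim)
open import Function.Bundles using (_⇔_; mk⇔)
open import Relation.Binary.Bundles using (DecTotalOrder)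
open import Relation.Binary.PropositionalEquality using (_≡_; _≢_; refl; sym; trans; cong; subst; subst₂; setoid; module ≡-Reasoning)
open import Relation.Nullary using (¬_; Dec; yes; no)
open import Relation.Nullary.Decidable using (_×-dec_)
import Relation.Binary.Construct.On as On
import Relation.Binary.Construct.Flip.EqAndOrd as Flip

module Generation {n : ℕ} (_∙_ : Fin n → Fin n → Fin n) where

  ⁺-mono : ∀ {ys zs} → ys ⊆ zs → ∀ x → _∈⁺_ _∙_ x ys → _∈⁺_ _∙_ x zs
  ⁺-mono ys⊆zs x (a , as , a∈ys , as⊆ys , prod≡x) =
    a , as , ys⊆zs a∈ys , All.map ys⊆zs as⊆ys , prod≡x

  strict-extension : ∀ ys x → ¬ (_∈⁺_ _∙_ x ys) → _⊂⁺_ _∙_ ys (ys ++ [ x ])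
  strict-extension ys x x∉ys⁺ =
    ⁺-mono ∈-++⁺ˡ , x , (x , [] , ∈-++⁺ʳ ys (here refl) , [] , refl) , x∉ys⁺

  -- R is independent if x avoids the subsemigroup generated by any list of
  -- elements p that are all R-related to x (R p x: "p may precede x").
  Independent : (Fin n → Fin n → Set) → Set
  Independent R = ∀ x pre → All (λ p → R p x) pre → ¬ (_∈⁺_ _∙_ x pre)

  prefix-chain : ∀ {R} → Independent R → ∀ pre xs →
    All (λ p → All (R p) xs) pre → AllPairs R xs →
    ∀ j → j < length xs → _⊂⁺_ _∙_ (pre ++ take j xs) (pre ++ take (suc j) xs)
  prefix-chain indep pre (x ∷ xs) pre-R (x-R ∷ xs-R) zero _ =
    subst (λ ys → _⊂⁺_ _∙_ ys (pre ++ [ x ])) (sym (++-identityʳ pre))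
      (strict-extension pre x (indep x pre (All.map All.head pre-R)))
  prefix-chain indep pre (x ∷ xs) pre-R (x-R ∷ xs-R) (suc j) (s≤s j<len) =
    subst₂ (_⊂⁺_ _∙_) (++-assoc pre [ x ] (take j xs)) (++-assoc pre [ x ] (take (suc j) xs))
      (prefix-chain indep (pre ++ [ x ]) xs (++⁺ (All.map All.tail pre-R) (x-R ∷ [])) xs-R j j<len)

indicator : {A : Set} → Dec A → ℕ
indicator (yes _) = 1
indicator (no _)  = 0

count : {P : ℕ → Set} → (∀ i → Dec (P i)) → ℕ → ℕ
count P? zero    = 0
count P? (suc l) = count P? l + indicator (P? l)

module _ {P : ℕ → Set} (P? : ∀ i → Dec (P i)) where

  count-last-fails : ∀ l → ¬ P l → count P? (suc l) ≡ count P? l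
  count-last-fails l ¬Pl with P? l
  ... | yes Pl = ⊥-elim (¬Pl Pl)
  ... | no _   = +-identityʳ (count P? l)

  count-≤ : ∀ l → count P? l ≤ l
  count-≤ zero    = z≤n
  count-≤ (suc l) = ≤-trans (+-mono-≤ (count-≤ l) (indicator-≤1 (P? l))) (≤-reflexive (+-comm l 1))
    where
    indicator-≤1 : {A : Set} (d : Dec A) → indicator d ≤ 1
    indicator-≤1 (yes _) = ≤-refl
    indicator-≤1 (no _)  = z≤n

  count-all : (∀ i → P i) → ∀ l → count P? l ≡ l
  count-all all-P zero    = refl
  count-all all-P (suc l) with P? l
  ... | yes _  = trans (cong (_+ 1) (count-all all-P l)) (+-comm l 1)
  ... | no ¬Pl = ⊥-elim (¬Pl (all-P l))

  count-shift : ∀ l → count P? (suc l) ≡ indicator (P? 0) + count (λ i → P? (suc i)) l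
  count-shift zero    = sym (+-identityʳ (indicator (P? 0)))
  count-shift (suc l) = begin
    count P? (suc l) + indicator (P? (suc l))
      ≡⟨ cong (_+ indicator (P? (suc l))) (count-shift l) ⟩
    indicator (P? 0) + count (λ i → P? (suc i)) l + indicator (P? (suc l))
      ≡⟨ +-assoc (indicator (P? 0)) _ _ ⟩
    indicator (P? 0) + count (λ i → P? (suc i)) (suc l) ∎
    where open ≡-Reasoning

  count-mono : {Q : ℕ → Set} (Q? : ∀ i → Dec (Q i)) → (∀ i → P i → Q i) → ∀ l → count P? l ≤ count Q? l
  count-mono Q? P⇒Q zero    = z≤n
  count-mono {Q} Q? P⇒Q (suc l) = +-mono-≤ (count-mono Q? P⇒Q l) (indicator-mono (P? l) (Q? l))
    where
    indicator-mono : (d : Dec (P l)) (e : Dec (Q l)) → indicator d ≤ indicator e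
    indicator-mono (yes Pl) (yes _) = ≤-refl
    indicator-mono (yes Pl) (no ¬Ql) = ⊥-elim (¬Ql (P⇒Q l Pl))
    indicator-mono (no _)   _       = z≤n

record Grading {n : ℕ} (_∙_ : Fin n → Fin n → Fin n) (z : Fin n) : Set where
  field
    rank          : Fin n → ℕ
    rank-grows    : ∀ a c → (a ∙ c) ≢ z → rank a < rank (a ∙ c)
    rank-zero-max : ∀ a → rank z ≤ rank a → a ≡ z

module Graded {n : ℕ} {_∙_ : Fin n → Fin n → Fin n} {z : Fin n} (grading : Grading _∙_ z) where
  open Grading grading
  open Generation _∙_

  Ahead : Fin n → Fin n → Set
  Ahead p x = p ≢ x × rank x ≤ rank p

  -- No element is generated by elements ahead of it: a single generator
  -- differs from x, a proper product a·c would have rank above rank a, and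
  -- a generator of 0 of rank ≥ rank 0 is 0 itself.
  ahead-independent : Independent Ahead
  ahead-independent x pre ahead (a , as , a∈pre , _ , prod≡x) with All.lookup ahead a∈pre | x ≟ z
  ... | a≢x , x≤a | yes refl = a≢x (rank-zero-max a x≤a)
  ahead-independent x pre ahead (a , [] , _ , _ , a≡x) | a≢x , _ | no _ = a≢x a≡x
  ahead-independent x pre ahead (a , b ∷ bs , _ , _ , a·c≡x) | _ , x≤a | no x≢z =
    <⇒≱ (subst (λ y → rank a < rank y) a·c≡x (rank-grows a (prod _∙_ b bs) a·c≢z)) x≤a
    where
    a·c≢z : (a ∙ prod _∙_ b bs) ≢ z
    a·c≢z a·c≡z = x≢z (trans (sym a·c≡x) a·c≡z)

  byDecreasingRank : DecTotalOrder _ _ _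
  byDecreasingRank = Flip.decTotalOrder (On.decTotalOrder ≤-decTotalOrder rank)

  open Sort byDecreasingRank using (sort; sort-↭; sort-↗)

  all-faces : (X : Subset n) → IsFace _∙_ X
  all-faces X = xs , unique , members , prefix-chain ahead-independent [] xs [] ahead-pairs
    where
    listed : List (Fin n)
    listed = filter (_∈ₛ? X) (allFin n)

    xs : List (Fin n)
    xs = sort listed

    unique : Unique xs
    unique = SetoidPermutation.Unique-resp-↭ (setoid (Fin n)) (↭⇒↭ₛ (↭-sym (sort-↭ listed)))
               (filter⁺ (_∈ₛ? X) (allFin⁺ n))

    members : ∀ i → (i ∈ₛ X) ⇔ (i ∈ xs)
    members i = mk⇔
      (λ i∈X → ∈-resp-↭ (↭-sym (sort-↭ listed)) (∈-filter⁺ (_∈ₛ? X) (∈-allFin i) i∈X))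
      (λ i∈xs → proj₂ (∈-filter⁻ (_∈ₛ? X) {xs = allFin n} (∈-resp-↭ (sort-↭ listed) i∈xs)))

    ahead-pairs : AllPairs Ahead xs
    ahead-pairs = AllPairs.zip (unique , Sorted⇒AllPairs (DecTotalOrder.totalOrder byDecreasingRank) (sort-↗ listed))

module Powers {n : ℕ} (_∙_ : Fin n → Fin n → Fin n) (assoc : Associative _∙_) where

  -- InPower m x: x ∈ N^(m+1), i.e. x is a product of m+1 elements.
  InPower : ℕ → Fin n → Set
  InPower zero    x = ⊤
  InPower (suc m) x = ∃[ a ] ∃[ b ] (InPower m b × (a ∙ b) ≡ x)

  inPower? : ∀ m x → Dec (InPower m x)
  inPower? zero    x = yes tt
  inPower? (suc m) x = any? (λ a → any? (λ b → inPower? m b ×-dec ((a ∙ b) ≟ x)))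

  power-product : ∀ m x → InPower m x → ∃[ v ] (prodVec _∙_ {m} v ≡ x)
  power-product zero    x _ = (x ∷ []) , refl
  power-product (suc m) x (a , b , b∈ , a·b≡x) with power-product m b b∈
  ... | (c ∷ cs) , prod≡b = (a ∷ c ∷ cs) , trans (cong (a ∙_) prod≡b) a·b≡x

  power-mul : ∀ m a c → InPower m a → InPower (suc m) (a ∙ c)
  power-mul zero    a c _ = a , c , tt , refl
  power-mul (suc m) a c (a′ , b , b∈ , a′·b≡a) =
    a′ , (b ∙ c) , power-mul m b c b∈ , trans (sym (assoc a′ b c)) (cong (_∙ c) a′·b≡a)

module NilpotentGrading {n : ℕ} (_∙_ : Fin n → Fin n → Fin n) (assoc : Associative _∙_)
  (z : Fin n) (isZero : IsZero _∙_ z)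
  (k : ℕ) (nil : ∀ (v : Vec (Fin n) (suc k)) → prodVec _∙_ v ≡ z) where
  open Powers _∙_ assoc

  top-power-zero : ∀ x → InPower k x → x ≡ z
  top-power-zero x x∈ with power-product k x x∈
  ... | v , prod≡x = trans (sym prod≡x) (nil v)

  zero-in-powers : ∀ m → InPower m z
  zero-in-powers zero    = tt
  zero-in-powers (suc m) = z , z , zero-in-powers m , proj₁ (isZero z)

  rank : Fin n → ℕ
  rank x = count (λ j → inPower? j x) (suc k)

  rank-below-top : ∀ a → ¬ InPower k a → rank a ≡ count (λ j → inPower? j a) k
  rank-below-top a = count-last-fails (λ j → inPower? j a) k

  -- If a·c ≠ 0 then a ∉ N^(k+1), and a ∈ N^(j+1) gives a·c ∈ N^(j+2);
  -- moreover a·c ∈ N^1, so a·c counts one power more than a.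
  rank-grows : ∀ a c → (a ∙ c) ≢ z → rank a < rank (a ∙ c)
  rank-grows a c a·c≢z = begin-strict
    rank a                                         ≡⟨ rank-below-top a a∉top ⟩
    count (λ j → inPower? j a) k                   ≤⟨ count-mono (λ j → inPower? j a) (λ j → inPower? (suc j) (a ∙ c)) (λ j → power-mul j a c) k ⟩
    count (λ j → inPower? (suc j) (a ∙ c)) k       <⟨ s≤s ≤-refl ⟩
    1 + count (λ j → inPower? (suc j) (a ∙ c)) k   ≡⟨ sym (count-shift (λ j → inPower? j (a ∙ c)) k) ⟩
    rank (a ∙ c)                                   ∎
    where
    open ≤-Reasoning
    a∉top : ¬ InPower k a
    a∉top a∈ = a·c≢z (trans (cong (_∙ c) (top-power-zero a a∈)) (proj₁ (isZero c)))

  -- 0 lies in every power, so it has the maximal rank k+1; any other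
  -- element misses N^(k+1) and has rank at most k.
  rank-zero-max : ∀ a → rank z ≤ rank a → a ≡ z
  rank-zero-max a z≤a = by-top-membership (inPower? k a)
    where
    open ≤-Reasoning
    by-top-membership : Dec (InPower k a) → a ≡ z
    by-top-membership (yes a∈top) = top-power-zero a a∈top
    by-top-membership (no a∉top)  = ⊥-elim (<⇒≱ (s≤s (count-≤ (λ j → inPower? j a) k)) (begin
      suc k   ≡⟨ sym (count-all (λ j → inPower? j z) zero-in-powers (suc k)) ⟩
      rank z  ≤⟨ z≤a ⟩
      rank a  ≡⟨ rank-below-top a a∉top ⟩
      count (λ j → inPower? j a) k ∎))

  grading : Grading _∙_ z
  grading = record { rank = rank ; rank-grows = rank-grows ; rank-zero-max = rank-zero-max }

theorem5p7 : (n : ℕ) (_∙_ : Fin (suc n) → Fin (suc n) → Fin (suc n)) →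
    Associative _∙_ → Nilpotent _∙_ → (X : Subset (suc n)) → IsFace _∙_ X
theorem5p7 n _∙_ assoc (z , isZero , k , nil) =
  Graded.all-faces (NilpotentGrading.grading _∙_ assoc z isZero k nil)
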